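{- Let $\Sigma$ be an alphabet of size $k$. Any partial word over $\Sigma$ in which exactly one position starts a square contains at most $k$ squares. Furthermore, for every $k$ there exists a partial word over an alphabet of size $k$ in which exactly one position starts a square and which contains exactly $k$ squares.
   Context: Let $\diamond \notin \Sigma$ be a hole symbol. A partial word over $\Sigma$ is a finite sequence over $\Sigma \cup \{\diamond\}$; a full word is one with no holes. Positions are indexed from $1$; $w[i..j]$ is the factor occupying positions $i$ to $j$, said to start at position $i$; a partial word contains a square if one of its factors is a square, and a position starts a square if some factor starting at that position is a square. For partial words $u, v$ of equal length, $u \subset v$ means that every non-hole position of $u$ is a non-hole position of $v$ carrying the same letter. A partial word $u$ is a square if $u \subset xx$ for some nonempty full word $x$. -}

module Defs where

open import Data.Nat using (ℕ; _+_; _≤_)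
open import Data.Fin using (Fin)
open import Data.Maybe using (Maybe; just; nothing)
open import Data.List using (List; []; _++_; map; length; take; drop)
open import Data.List.Relation.Binary.Pointwise using (Pointwise)
open import Data.Product using (Σ; _×_; ∃; _,_)
open import Data.Unit using (⊤)
open import Relation.Binary.PropositionalEquality using (_≡_; _≢_)

-- A partial word over the alphabet Fin k: `nothing` is the hole ◇.
PWord : ℕ → Set
PWord k = List (Maybe (Fin k))

FWord : ℕ → Set
FWord k = List (Fin k)

full : ∀ {k} → FWord k → PWord k
full = map just

_⊑_ : ∀ {k} → Maybe (Fin k) → Maybe (Fin k) → Set
nothing ⊑ _ = ⊤
just a  ⊑ b = b ≡ just a

_⊂_ : ∀ {k} → PWord k → PWord k → Set
u ⊂ v = Pointwise _⊑_ u v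

IsSquare : ∀ {k} → PWord k → Set
IsSquare {k} u = Σ (FWord k) λ x → x ≢ [] × u ⊂ full (x ++ x)

factor : ∀ {k} → PWord k → ℕ → ℕ → PWord k
factor w i l = take l (drop i w)

SquareAt : ∀ {k} → PWord k → ℕ × ℕ → Set
SquareAt w (i , l) = i + l ≤ length w × IsSquare (factor w i l)

StartsSquare : ∀ {k} → PWord k → ℕ → Set
StartsSquare w i = ∃ λ l → SquareAt w (i , l)

ExactlyOneSquareStart : ∀ {k} → PWord k → Set
ExactlyOneSquareStart w =
  ∃ λ i → StartsSquare w i × (∀ j → StartsSquare w j → j ≡ i)

module Submission where

-- Let i be the position starting squares and v = drop i w.  All
-- squares of v start at 0, and every occurrence in w is (i , m + m) for a
-- square of half m at the start of v.  Inside v there are no holes except at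
-- its ends (a hole at p > 0 starts the square v[p] v[p+1]).  If squares at 0
-- with halves m₁ < m₂ had equal letters at their centres m₁ and m₂, relaying
-- compatibility through interior letters would give a square of half m₂ - m₁
-- at m₁ (when m₂ ≤ 2m₁) or of half m₁ at m₂ (when m₂ > 2m₁).  So the centre
-- letter determines the half, and pigeonhole bounds the count by k.
--
-- With Zimin words Z₀ = ε, Zₙ₊₁ = Zₙ n Zₙ, the squares of ◇ Zₖ
-- are exactly ◇ Zₑ e Zₑ for e < k: a later square would be a repetition in
-- the square-free Zₖ, and a square at 0 is a prefix u a u of Zₖ.

open import Defs
open import Data.Nat using (ℕ; zero; suc; _+_; _∸_; _≤_; _<_; _≥_; z≤n; s≤s; s≤s⁻¹; _≤′_; ≤′-refl; ≤′-step;
                            ⌊_/2⌋; _≟_; _≤?_; _<?_; NonZero)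
open import Data.Nat.Properties
open import Data.Nat.DivMod using (_mod_; _%_; m<n⇒m%n≡m)
open import Data.Fin using (Fin; zero; suc; toℕ)
import Data.Fin.Properties as Fin
open import Data.Maybe using (Maybe; just; nothing; fromMaybe)
import Data.Maybe as Maybe
open import Data.List using (List; []; _∷_; _++_; map; length; take; drop; applyUpTo; lookup; upTo)
open import Data.List.Properties
  using (length-++; length-map; length-drop; length-applyUpTo; length-upTo; drop-drop; ++-assoc; ++-identityʳ)
open import Data.List.Relation.Binary.Pointwise using ([]; _∷_; Pointwise-length)
open import Data.List.Relation.Unary.All using (All; []; _∷_)
import Data.List.Relation.Unary.All as All
import Data.List.Relation.Unary.All.Properties as All
open import Data.List.Relation.Unary.AllPairs using ([]; _∷_)
open import Data.List.Relation.Unary.Unique.Propositional using (Unique)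
import Data.List.Relation.Unary.Unique.Propositional.Properties as Unique
open import Data.List.Membership.Propositional using (_∈_)
open import Data.List.Membership.Propositional.Properties using (∈-lookup; ∈-map⁺; ∈-upTo⁺; ∈-upTo⁻)
open import Data.Product using (Σ; ∃; _×_; _,_; proj₁; proj₂)
open import Data.Sum using (_⊎_; inj₁; inj₂)
open import Data.Unit using (⊤; tt)
open import Data.Empty using (⊥; ⊥-elim)
open import Function using (_∘_)
open import Relation.Nullary using (¬_; yes; no)
open import Relation.Binary.Definitions using (tri<; tri≈; tri>)
open import Relation.Binary.PropositionalEquality

private
  variable
    A B : Set
    k : ℕ

infixl 25 _‼_
_‼_ : List A → ℕ → Maybe A
[] ‼ _ = nothing
(x ∷ xs) ‼ zero = just x
(x ∷ xs) ‼ suc p = xs ‼ p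

‼-++ˡ : (xs ys : List A) {p : ℕ} → p < length xs → (xs ++ ys) ‼ p ≡ xs ‼ p
‼-++ˡ (x ∷ xs) ys {zero} _ = refl
‼-++ˡ (x ∷ xs) ys {suc p} (s≤s p<n) = ‼-++ˡ xs ys p<n

‼-++ʳ : (xs ys : List A) (p : ℕ) → (xs ++ ys) ‼ (length xs + p) ≡ ys ‼ p
‼-++ʳ [] ys p = refl
‼-++ʳ (x ∷ xs) ys p = ‼-++ʳ xs ys p

‼-drop : (i : ℕ) (xs : List A) (p : ℕ) → drop i xs ‼ p ≡ xs ‼ (i + p)
‼-drop zero xs p = refl
‼-drop (suc i) [] p = refl
‼-drop (suc i) (x ∷ xs) p = ‼-drop i xs p

‼-take : (l : ℕ) (xs : List A) {p : ℕ} → p < l → take l xs ‼ p ≡ xs ‼ p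
‼-take (suc l) [] _ = refl
‼-take (suc l) (x ∷ xs) {zero} _ = refl
‼-take (suc l) (x ∷ xs) {suc p} (s≤s p<l) = ‼-take l xs p<l

‼-map : (f : A → B) (xs : List A) (p : ℕ) → map f xs ‼ p ≡ Maybe.map f (xs ‼ p)
‼-map f [] p = refl
‼-map f (x ∷ xs) zero = refl
‼-map f (x ∷ xs) (suc p) = ‼-map f xs p

‼-applyUpTo : (f : ℕ → A) (n : ℕ) {p : ℕ} → p < n → applyUpTo f n ‼ p ≡ just (f p)
‼-applyUpTo f (suc n) {zero} _ = refl
‼-applyUpTo f (suc n) {suc p} (s≤s p<n) = ‼-applyUpTo (λ t → f (suc t)) n p<n

‼-inRange : (xs : List A) {p : ℕ} → p < length xs → ∃ λ a → xs ‼ p ≡ just a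
‼-inRange (x ∷ xs) {zero} _ = x , refl
‼-inRange (x ∷ xs) {suc p} (s≤s p<n) = ‼-inRange xs p<n

‼-All : {P : A → Set} {xs : List A} (p : ℕ) {a : A} → All P xs → xs ‼ p ≡ just a → P a
‼-All zero (pa ∷ _) refl = pa
‼-All (suc p) (_ ∷ pxs) eq = ‼-All p pxs eq

map-injectiveOn : {P : A → Set} (f : A → B) → (∀ {x y} → P x → P y → f x ≡ f y → x ≡ y) →
                  {xs : List A} → All P xs → Unique xs → Unique (map f xs)
map-injectiveOn f inj [] [] = []
map-injectiveOn f inj (px ∷ pxs) (x∉xs ∷ unique) =
  All.map⁺ (All.zipWith (λ (py , x≢y) fx≡fy → x≢y (inj px py fx≡fy)) (pxs , x∉xs))
  ∷ map-injectiveOn f inj pxs unique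

lookup-injective : {xs : List A} → Unique xs → (i j : Fin (length xs)) →
                   lookup xs i ≡ lookup xs j → i ≡ j
lookup-injective (_ ∷ _) zero zero _ = refl
lookup-injective (x∉xs ∷ _) zero (suc j) eq = ⊥-elim (All.lookup x∉xs (∈-lookup j) eq)
lookup-injective (x∉xs ∷ _) (suc i) zero eq = ⊥-elim (All.lookup x∉xs (∈-lookup i) (sym eq))
lookup-injective (_ ∷ unique) (suc i) (suc j) eq = cong suc (lookup-injective unique i j eq)

unique-length≤ : {xs : List (Fin k)} → Unique xs → length xs ≤ k
unique-length≤ {k} {xs} unique with length xs ≤? k
... | yes ≤k = ≤k
... | no ≰k with Fin.pigeonhole (≰⇒> ≰k) (lookup xs)
... | i , j , i<j , same = ⊥-elim (Fin.<⇒≢ i<j (lookup-injective unique i j same))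

-- The symbol of a partial word at position p; holes and positions outside
-- the word both read as `nothing`.
infixl 25 _!_
_!_ : PWord k → ℕ → Maybe (Fin k)
w ! p = fromMaybe nothing (w ‼ p)

full-! : (x : FWord k) (p : ℕ) → full x ! p ≡ x ‼ p
full-! x p rewrite ‼-map just x p with x ‼ p
... | just _ = refl
... | nothing = refl

factor-! : (w : PWord k) (p l : ℕ) {t : ℕ} → t < l → factor w p l ! t ≡ w ! (p + t)
factor-! w p l {t} t<l = cong (fromMaybe nothing)
  (trans (‼-take l (drop p w) t<l) (‼-drop p w t))

length-factor : (w : PWord k) (p l : ℕ) → p + l ≤ length w → length (factor w p l) ≡ l
length-factor w zero zero _ = refl
length-factor (a ∷ w) zero (suc l) (s≤s b) = cong suc (length-factor w zero l b)
length-factor (a ∷ w) (suc p) l (s≤s b) = length-factor w p l b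

⊂-! : {u v : PWord k} → u ⊂ v → (t : ℕ) → (u ! t) ⊑ (v ! t)
⊂-! [] t = tt
⊂-! (a⊑b ∷ _) zero = a⊑b
⊂-! (_ ∷ u⊂v) (suc t) = ⊂-! u⊂v t

!-⊂ : (u v : PWord k) → length u ≡ length v →
      ((t : ℕ) → t < length u → (u ! t) ⊑ (v ! t)) → u ⊂ v
!-⊂ [] [] _ _ = []
!-⊂ (a ∷ u) (b ∷ v) eq f =
  f 0 (s≤s z≤n) ∷ !-⊂ u v (suc-injective eq) (λ t t<n → f (suc t) (s≤s t<n))

-- Compatibility of symbols: two symbols are compatible unless they are
-- distinct letters.  A square is a word whose halves are compatible
-- position by position.
infix 4 _↑_
_↑_ : Maybe (Fin k) → Maybe (Fin k) → Set
just a ↑ just b = a ≡ b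
nothing ↑ _ = ⊤
just _ ↑ nothing = ⊤

↑-refl : (a : Maybe (Fin k)) → a ↑ a
↑-refl (just _) = refl
↑-refl nothing = tt

↑-sym : (a b : Maybe (Fin k)) → a ↑ b → b ↑ a
↑-sym (just _) (just _) a≡b = sym a≡b
↑-sym (just _) nothing _ = tt
↑-sym nothing (just _) _ = tt
↑-sym nothing nothing _ = tt

-- Compatibility is transitive through a letter (not through a hole).
↑-trans : (a : Maybe (Fin k)) {b : Fin k} (c : Maybe (Fin k)) →
          a ↑ just b → just b ↑ c → a ↑ c
↑-trans (just _) (just _) a≡b b≡c = trans a≡b b≡c
↑-trans (just _) nothing _ _ = tt
↑-trans nothing _ _ _ = tt

⊑-↑ : (a b c : Maybe (Fin k)) → a ⊑ c → b ⊑ c → a ↑ b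
⊑-↑ (just _) (just _) _ refl refl = refl
⊑-↑ (just _) nothing _ _ _ = tt
⊑-↑ nothing _ _ _ _ = tt

join : Maybe (Fin k) → Maybe (Fin k) → Fin k → Fin k
join (just a) _ _ = a
join nothing (just b) _ = b
join nothing nothing d = d

join-⊑ˡ : (a b : Maybe (Fin k)) (d : Fin k) → a ⊑ just (join a b d)
join-⊑ˡ (just _) _ _ = refl
join-⊑ˡ nothing _ _ = tt

join-⊑ʳ : (a b : Maybe (Fin k)) (d : Fin k) → a ↑ b → b ⊑ just (join a b d)
join-⊑ʳ (just _) (just _) _ a≡b = cong just a≡b
join-⊑ʳ (just _) nothing _ _ = tt
join-⊑ʳ nothing (just _) _ _ = refl
join-⊑ʳ nothing nothing _ _ = tt

record Square (w : PWord k) (p m : ℕ) : Set where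
  field
    nonempty : 1 ≤ m
    fits     : p + (m + m) ≤ length w
    matches  : (t : ℕ) → t < m → w ! (p + t) ↑ w ! (p + m + t)

square-half : (w : PWord k) (p l : ℕ) → SquareAt w (p , l) →
              Σ ℕ λ m → l ≡ m + m × Square w p m
square-half w p l (fits , x , x≢[] , u⊂xx) = m , l≡m+m , record
  { nonempty = nonempty x x≢[]
  ; fits = subst (λ n → p + n ≤ length w) l≡m+m fits
  ; matches = matches }
  where
    m = length x
    u = factor w p l
    l≡m+m : l ≡ m + m
    l≡m+m = begin
      l                          ≡⟨ length-factor w p l fits ⟨
      length u                   ≡⟨ Pointwise-length u⊂xx ⟩
      length (full (x ++ x))     ≡⟨ length-map just (x ++ x) ⟩
      length (x ++ x)            ≡⟨ length-++ x ⟩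
      m + m                      ∎
      where open ≡-Reasoning
    nonempty : (y : FWord k) → y ≢ [] → 1 ≤ length y
    nonempty [] y≢[] = ⊥-elim (y≢[] refl)
    nonempty (_ ∷ _) _ = s≤s z≤n
    -- both u ! t and u ! (m + t) are contained in the letter x ‼ t
    matches : (t : ℕ) → t < m → w ! (p + t) ↑ w ! (p + m + t)
    matches t t<m =
      subst₂ _↑_ (factor-! w p l first) (trans (factor-! w p l second) (cong (w !_) (sym (+-assoc p m t))))
      (⊑-↑ (u ! t) (u ! (m + t)) (x ‼ t)
        (subst (u ! t ⊑_) (trans (full-! (x ++ x) t) (‼-++ˡ x x t<m)) (⊂-! u⊂xx t))
        (subst (u ! (m + t) ⊑_) (trans (full-! (x ++ x) (m + t)) (‼-++ʳ x x t)) (⊂-! u⊂xx (m + t))))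
      where
        second : m + t < l
        second = subst (m + t <_) (sym l≡m+m) (+-monoʳ-< m t<m)
        first : t < l
        first = ≤-<-trans (m≤n+m t m) second

-- Conversely every `Square` is a square occurrence: its first half, with
-- each hole filled from the second half (or by the letter d), is the x of
-- the definition.
square-intro : (d : Fin k) (w : PWord k) (p m : ℕ) → Square w p m → SquareAt w (p , m + m)
square-intro {k} d w p m sq = fits , x , x≢[] , !-⊂ u (full (x ++ x)) lengths contained
  where
    open Square sq
    letter : ℕ → Fin k
    letter t = join (w ! (p + t)) (w ! (p + m + t)) d
    x = applyUpTo letter m
    u = factor w p (m + m)
    ∣x∣≡m : length x ≡ m
    ∣x∣≡m = length-applyUpTo letter m
    x≢[] : x ≢ []
    x≢[] x≡[] = 1+n≰n (≤-trans nonempty (≤-reflexive (trans (sym ∣x∣≡m) (cong length x≡[]))))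
    ∣u∣≡m+m : length u ≡ m + m
    ∣u∣≡m+m = length-factor w p (m + m) fits
    lengths : length u ≡ length (full (x ++ x))
    lengths = begin
      length u                ≡⟨ ∣u∣≡m+m ⟩
      m + m                   ≡⟨ cong₂ _+_ ∣x∣≡m ∣x∣≡m ⟨
      length x + length x     ≡⟨ length-++ x ⟨
      length (x ++ x)         ≡⟨ length-map just (x ++ x) ⟨
      length (full (x ++ x))  ∎
      where open ≡-Reasoning
    contained : (t : ℕ) → t < length u → u ! t ⊑ full (x ++ x) ! t
    contained t t<∣u∣ with t <? m
    ... | yes t<m = subst₂ _⊑_ (sym (factor-! w p (m + m) t<m+m)) (sym xx[t])
                      (join-⊑ˡ (w ! (p + t)) (w ! (p + m + t)) d)
      where
        t<m+m = subst (t <_) ∣u∣≡m+m t<∣u∣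
        xx[t] : full (x ++ x) ! t ≡ just (letter t)
        xx[t] = begin
          full (x ++ x) ! t  ≡⟨ full-! (x ++ x) t ⟩
          (x ++ x) ‼ t       ≡⟨ ‼-++ˡ x x (subst (t <_) (sym ∣x∣≡m) t<m) ⟩
          x ‼ t              ≡⟨ ‼-applyUpTo letter m t<m ⟩
          just (letter t)    ∎
          where open ≡-Reasoning
    ... | no t≮m = subst₂ _⊑_ (sym u[t]) (sym xx[t])
                     (join-⊑ʳ (w ! (p + s)) (w ! (p + m + s)) d (matches s s<m))
      where
        s = t ∸ m
        t≡m+s : t ≡ m + s
        t≡m+s = sym (m+[n∸m]≡n (≮⇒≥ t≮m))
        t<m+m = subst (t <_) ∣u∣≡m+m t<∣u∣
        s<m : s < m
        s<m = +-cancelˡ-< m s m (subst (_< m + m) t≡m+s t<m+m)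
        u[t] : u ! t ≡ w ! (p + m + s)
        u[t] = trans (factor-! w p (m + m) t<m+m) (cong (w !_) (trans (cong (p +_) t≡m+s) (sym (+-assoc p m s))))
        xx[t] : full (x ++ x) ! t ≡ just (letter s)
        xx[t] = begin
          full (x ++ x) ! t         ≡⟨ full-! (x ++ x) t ⟩
          (x ++ x) ‼ t              ≡⟨ cong ((x ++ x) ‼_) (trans t≡m+s (cong (_+ s) (sym ∣x∣≡m))) ⟩
          (x ++ x) ‼ (length x + s) ≡⟨ ‼-++ʳ x x s ⟩
          x ‼ s                     ≡⟨ ‼-applyUpTo letter m s<m ⟩
          just (letter s)           ∎
          where open ≡-Reasoning

square-suffix⁺ : (w : PWord k) (i p l : ℕ) → SquareAt w (i + p , l) → SquareAt (drop i w) (p , l)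
square-suffix⁺ w i p l (fits , square) =
  subst (p + l ≤_) (sym (length-drop i w)) (m+n≤o⇒m≤o∸n (p + l) shifted) ,
  subst IsSquare (cong (take l) (sym (drop-drop i p w))) square
  where
    shifted : p + l + i ≤ length w
    shifted = subst (_≤ length w) (trans (+-assoc i p l) (+-comm i (p + l))) fits

square-suffix⁻ : (w : PWord k) (i p l : ℕ) → i ≤ length w →
                 SquareAt (drop i w) (p , l) → SquareAt w (i + p , l)
square-suffix⁻ w i p l i≤∣w∣ (fits , square) =
  subst (_≤ length w) (trans (+-comm (p + l) i) (sym (+-assoc i p l)))
        (m≤o∸n⇒m+n≤o (p + l) i≤∣w∣ (subst (p + l ≤_) (length-drop i w) fits)) ,
  subst IsSquare (cong (take l) (drop-drop i p w)) square

module SquaresAtStart {k : ℕ} (v : PWord k)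
                      (only-at-start : ∀ {p m} → Square v p m → p ≡ 0) where

  -- v has no hole strictly between its first and last positions: a hole at
  -- p together with position p + 1 would be a square of length 2.
  interior-letter : (p : ℕ) → 1 ≤ p → suc p < length v → ∃ λ a → v ! p ≡ just a
  interior-letter p 1≤p inside with v ! p in hole
  ... | just a = a , refl
  ... | nothing = ⊥-elim (n>0⇒n≢0 1≤p (only-at-start hole-square))
    where
      hole-square : Square v p 1
      hole-square = record
        { nonempty = ≤-refl
        ; fits = subst (_≤ length v) (+-comm 2 p) inside
        ; matches = λ { zero _ → subst (λ a → a ↑ v ! (p + 1 + 0))
                                       (sym (trans (cong (v !_) (+-identityʳ p)) hole)) tt
                      ; (suc _) (s≤s ()) } }

  -- Compatibility passes through interior positions, as they carry letters.
  relay : (a : Maybe (Fin k)) (q : ℕ) (c : Maybe (Fin k)) → 1 ≤ q → suc q < length v →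
          a ↑ v ! q → v ! q ↑ c → a ↑ c
  relay a q c 1≤q inside a↑q q↑c with interior-letter q 1≤q inside
  ... | b , q≡b = ↑-trans a c (subst (a ↑_) q≡b a↑q) (subst (_↑ c) q≡b q↑c)

  inside-square : {m q : ℕ} → Square v 0 m → 2 ≤ m → q ≤ m → suc q < length v
  inside-square {m} sq 2≤m q≤m =
    ≤-trans (s≤s (s≤s q≤m)) (≤-trans (subst (_≤ m + m) (+-comm m 2) (+-monoʳ-≤ m 2≤m)) (Square.fits sq))

  larger : {p m₁ m₂ : ℕ} → Square v p m₁ → m₁ < m₂ → 2 ≤ m₂
  larger sq₁ m₁<m₂ = ≤-trans (s≤s (Square.nonempty sq₁)) m₁<m₂

  same-letter : {p q : ℕ} {a : Fin k} → v ! p ≡ just a → v ! q ≡ just a → v ! p ↑ v ! q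
  same-letter {a = a} p≡a q≡a = subst₂ _↑_ (sym p≡a) (sym q≡a) (↑-refl (just a))

  module TwoSquares {m₁ m₂ : ℕ} (sq₁ : Square v 0 m₁) (sq₂ : Square v 0 m₂) (m₁<m₂ : m₁ < m₂)
                    {a : Fin k} (centre₁ : v ! m₁ ≡ just a) (centre₂ : v ! m₂ ≡ just a) where
    open Square sq₁ renaming (nonempty to 1≤m₁; matches to match₁)
    open Square sq₂ renaming (fits to fits₂; matches to match₂)

    interior : {q : ℕ} → q ≤ m₂ → suc q < length v
    interior = inside-square sq₂ (larger sq₁ m₁<m₂)

    -- If m₂ ≤ 2m₁ the squares overlap: v[m₁ + t] ~ v[t] ~ v[m₂ + t] gives a
    -- square of half m₂ - m₁ at m₁.
    overlapping : m₂ ≤ m₁ + m₁ → Square v m₁ (m₂ ∸ m₁)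
    overlapping m₂≤2m₁ = record
      { nonempty = m<n⇒0<n∸m m₁<m₂
      ; fits = subst (_≤ length v) (trans (cong (_+ δ) (sym m₁+δ≡m₂)) (+-assoc m₁ δ δ))
                 (≤-trans (+-monoʳ-≤ m₂ (m∸n≤m m₂ m₁)) fits₂)
      ; matches = λ t t<δ → subst (λ n → v ! (m₁ + t) ↑ v ! (n + t)) (sym m₁+δ≡m₂) (match t t<δ) }
      where
        δ = m₂ ∸ m₁
        m₁+δ≡m₂ : m₁ + δ ≡ m₂
        m₁+δ≡m₂ = m+[n∸m]≡n (<⇒≤ m₁<m₂)
        δ≤m₁ : δ ≤ m₁
        δ≤m₁ = m≤n+o⇒m∸n≤o m₂ m₁ m₂≤2m₁
        match : (t : ℕ) → t < δ → v ! (m₁ + t) ↑ v ! (m₂ + t)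
        match zero _ = same-letter (trans (cong (v !_) (+-identityʳ m₁)) centre₁)
                                   (trans (cong (v !_) (+-identityʳ m₂)) centre₂)
        match t@(suc _) t<δ =
          relay (v ! (m₁ + t)) t (v ! (m₂ + t)) (s≤s z≤n) (interior (<⇒≤ t<m₂))
            (↑-sym (v ! t) (v ! (m₁ + t)) (match₁ t (<-≤-trans t<δ δ≤m₁))) (match₂ t t<m₂)
          where
            t<m₂ = <-≤-trans t<δ (m∸n≤m m₂ m₁)

    -- If m₂ > 2m₁ the first square reappears at m₂:
    -- v[m₂ + t] ~ v[t] ~ v[m₁ + t] ~ v[m₂ + m₁ + t].
    separated : m₁ + m₁ < m₂ → Square v m₂ m₁
    separated 2m₁<m₂ = record
      { nonempty = 1≤m₁
      ; fits = ≤-trans (+-monoʳ-≤ m₂ (<⇒≤ 2m₁<m₂)) fits₂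
      ; matches = match }
      where
        match : (t : ℕ) → t < m₁ → v ! (m₂ + t) ↑ v ! (m₂ + m₁ + t)
        match zero _ = subst₂ _↑_ (trans centre₁ (sym (trans (cong (v !_) (+-identityʳ m₂)) centre₂)))
                                  (cong (v !_) (sym (+-identityʳ (m₂ + m₁))))
                                  (match₂ m₁ m₁<m₂)
        match t@(suc _) t<m₁ =
          relay (v ! (m₂ + t)) (m₁ + t) (v ! (m₂ + m₁ + t)) (≤-trans 1≤m₁ (m≤m+n m₁ t)) (interior (<⇒≤ m₁+t<m₂))
            (relay (v ! (m₂ + t)) t (v ! (m₁ + t)) (s≤s z≤n) (interior (<⇒≤ t<m₂))
              (↑-sym (v ! t) (v ! (m₂ + t)) (match₂ t t<m₂)) (match₁ t t<m₁))
            (subst (λ n → v ! (m₁ + t) ↑ v ! n) (sym (+-assoc m₂ m₁ t)) (match₂ (m₁ + t) m₁+t<m₂))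
          where
            m₁+t<m₂ = <-trans (+-monoʳ-< m₁ t<m₁) 2m₁<m₂
            t<m₂ = <-trans t<m₁ m₁<m₂

  centres-differ : {m₁ m₂ : ℕ} {a : Fin k} → Square v 0 m₁ → Square v 0 m₂ → m₁ < m₂ →
                   v ! m₁ ≡ just a → v ! m₂ ≡ just a → ⊥
  centres-differ {m₁} {m₂} sq₁ sq₂ m₁<m₂ centre₁ centre₂ with m₂ ≤? m₁ + m₁
  ... | yes m₂≤2m₁ = n>0⇒n≢0 (Square.nonempty sq₁) (only-at-start (overlapping m₂≤2m₁))
    where open TwoSquares sq₁ sq₂ m₁<m₂ centre₁ centre₂
  ... | no m₂≰2m₁ = n>0⇒n≢0 (≤-trans (Square.nonempty sq₁) (<⇒≤ m₁<m₂)) (only-at-start (separated (≰⇒> m₂≰2m₁)))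
    where open TwoSquares sq₁ sq₂ m₁<m₂ centre₁ centre₂

  centre : Fin k → ℕ → Fin k
  centre d m = fromMaybe d (v ! m)

  -- Below a larger square, the centre of a square at 0 is a letter, so two
  -- such centres cannot agree.
  centres-distinct : (d : Fin k) {m₁ m₂ : ℕ} → Square v 0 m₁ → Square v 0 m₂ → m₁ < m₂ →
                  centre d m₁ ≢ centre d m₂
  centres-distinct d {m₁} {m₂} sq₁ sq₂ m₁<m₂ same
    with interior-letter m₁ (Square.nonempty sq₁) (inside-square sq₂ (larger sq₁ m₁<m₂) (<⇒≤ m₁<m₂))
       | interior-letter m₂ (<⇒≤ (larger sq₁ m₁<m₂)) (inside-square sq₂ (larger sq₁ m₁<m₂) ≤-refl)
  ... | a₁ , centre₁ | a₂ , centre₂ =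
    centres-differ sq₁ sq₂ m₁<m₂ centre₁ (trans centre₂ (cong just (sym a₁≡a₂)))
    where
      a₁≡a₂ : a₁ ≡ a₂
      a₁≡a₂ = trans (cong (fromMaybe d) (sym centre₁)) (trans same (cong (fromMaybe d) centre₂))

  centre-injective : (d : Fin k) {m₁ m₂ : ℕ} → Square v 0 m₁ → Square v 0 m₂ →
                     centre d m₁ ≡ centre d m₂ → m₁ ≡ m₂
  centre-injective d {m₁} {m₂} sq₁ sq₂ same with <-cmp m₁ m₂
  ... | tri< m₁<m₂ _ _ = ⊥-elim (centres-distinct d sq₁ sq₂ m₁<m₂ same)
  ... | tri≈ _ m₁≡m₂ _ = m₁≡m₂
  ... | tri> _ _ m₂<m₁ = ⊥-elim (centres-distinct d sq₂ sq₁ m₂<m₁ (sym same))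

  halves-bound : Fin k → (ms : List ℕ) → Unique ms → All (Square v 0) ms → length ms ≤ k
  halves-bound d ms distinct squares = begin
    length ms                   ≡⟨ length-map (centre d) ms ⟨
    length (map (centre d) ms)  ≤⟨ unique-length≤ (map-injectiveOn (centre d) (centre-injective d) squares distinct) ⟩
    k                           ∎
    where open ≤-Reasoning

half : ℕ × ℕ → ℕ
half (_ , l) = ⌊ l /2⌋

head-letter : (x : FWord k) → x ≢ [] → Fin k
head-letter [] x≢[] = ⊥-elim (x≢[] refl)
head-letter (a ∷ _) _ = a

-- If only position i starts a square, then all
-- occurrences are (i , h + h) with a square of half h at the start of
-- drop i w, a word whose squares all start at 0; so halves-bound applies.
at-most-k-squares : (w : PWord k) → ExactlyOneSquareStart w →
                    (occs : List (ℕ × ℕ)) → Unique occs → All (SquareAt w) occs → length occs ≤ k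
at-most-k-squares {k} w (i , (l , (fits , x , x≢[] , _)) , only-i) occs distinct squares = begin
  length occs             ≡⟨ length-map half occs ⟨
  length (map half occs)  ≤⟨ halves-bound (head-letter x x≢[]) (map half occs)
                               (map-injectiveOn half half-injective squares distinct)
                               (All.map⁺ (All.map (proj₂ ∘ shape) squares)) ⟩
  k                       ∎
  where
    open ≤-Reasoning
    v = drop i w

    -- a square of v at p is a square of w at i + p, so p = 0
    only-at-start : ∀ {p m} → Square v p m → p ≡ 0
    only-at-start {p} {m} sq = +-cancelˡ-≡ i p 0 (trans (only-i (i + p) (m + m , shifted)) (sym (+-identityʳ i)))
      where
        shifted : SquareAt w (i + p , m + m)
        shifted = square-suffix⁻ w i p (m + m) (≤-trans (m≤m+n i l) fits)
                    (square-intro (head-letter x x≢[]) v p m sq)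

    open SquaresAtStart v only-at-start using (halves-bound)

    at-i : ∀ {j l} → SquareAt w (j , l) → SquareAt w (i + 0 , l)
    at-i {j} {l} sq = subst (λ n → SquareAt w (n , l)) (trans (only-i j (l , sq)) (sym (+-identityʳ i))) sq

    shape : ∀ {o} → SquareAt w o → o ≡ (i , half o + half o) × Square v 0 (half o)
    shape {j , l} sq with square-half v 0 l (square-suffix⁺ w i 0 l (at-i sq))
    ... | m , l≡m+m , start-square =
      cong₂ _,_ (only-i j (l , sq)) (trans l≡m+m (cong (λ h → h + h) m≡h)) , subst (Square v 0) m≡h start-square
      where
        m≡h : m ≡ ⌊ l /2⌋
        m≡h = trans (n≡⌊n+n/2⌋ m) (cong ⌊_/2⌋ (sym l≡m+m))

    half-injective : ∀ {o₁ o₂} → SquareAt w o₁ → SquareAt w o₂ → half o₁ ≡ half o₂ → o₁ ≡ o₂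
    half-injective sq₁ sq₂ same =
      trans (proj₁ (shape sq₁)) (trans (cong (λ h → (i , h + h)) same) (sym (proj₁ (shape sq₂))))

Repetition : List A → ℕ → ℕ → Set
Repetition xs j m = (t : ℕ) → t < m → xs ‼ (j + t) ≡ xs ‼ (j + m + t)

repetition-++ˡ : (xs ys : List A) {j m : ℕ} → j + (m + m) ≤ length xs →
                 Repetition (xs ++ ys) j m → Repetition xs j m
repetition-++ˡ xs ys {j} {m} fits rep t t<m =
  trans (sym (‼-++ˡ xs ys (≤-<-trans (+-monoʳ-≤ j (m≤n+m t m)) second)))
        (trans (rep t t<m) (‼-++ˡ xs ys (subst (_< length xs) (sym (+-assoc j m t)) second)))
  where
    second : j + (m + t) < length xs
    second = <-≤-trans (+-monoʳ-< j (+-monoʳ-< m t<m)) fits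

repetition-++ʳ : (xs ys : List A) {j m : ℕ} → Repetition (xs ++ ys) (length xs + j) m → Repetition ys j m
repetition-++ʳ xs ys {j} {m} rep t t<m = begin
  ys ‼ (j + t)                        ≡⟨ ‼-++ʳ xs ys (j + t) ⟨
  (xs ++ ys) ‼ (length xs + (j + t))  ≡⟨ cong ((xs ++ ys) ‼_) (+-assoc (length xs) j t) ⟨
  (xs ++ ys) ‼ (length xs + j + t)    ≡⟨ rep t t<m ⟩
  (xs ++ ys) ‼ (length xs + j + m + t) ≡⟨ cong ((xs ++ ys) ‼_) (trans (+-assoc (length xs + j) m t) (+-assoc (length xs) j (m + t))) ⟩
  (xs ++ ys) ‼ (length xs + (j + (m + t))) ≡⟨ ‼-++ʳ xs ys (j + (m + t)) ⟩
  ys ‼ (j + (m + t))                  ≡⟨ cong (ys ‼_) (+-assoc j m t) ⟨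
  ys ‼ (j + m + t)                    ∎
  where open ≡-Reasoning

-- xs has period m on its prefix of length 2m - 1, i.e. begins u a u with ∣u∣ = m - 1.
PeriodicPrefix : List A → ℕ → Set
PeriodicPrefix xs m = (s : ℕ) → suc s < m → xs ‼ s ≡ xs ‼ (m + s)

periodicPrefix-++ˡ : (xs ys : List A) {m : ℕ} → m + m ≤ suc (length xs) →
                     PeriodicPrefix (xs ++ ys) m → PeriodicPrefix xs m
periodicPrefix-++ˡ xs ys {m} fits per s s+1<m =
  trans (sym (‼-++ˡ xs ys (≤-<-trans (m≤n+m s m) second))) (trans (per s s+1<m) (‼-++ˡ xs ys second))
  where
    second : m + s < length xs
    second = s≤s⁻¹ (≤-trans (subst (_≤ m + m) (trans (+-suc m (suc s)) (cong suc (+-suc m s))) (+-monoʳ-≤ m s+1<m)) fits)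

zimin : ℕ → List ℕ
zimin zero = []
zimin (suc n) = zimin n ++ n ∷ zimin n

size : ℕ → ℕ
size n = length (zimin n)

size-suc : (n : ℕ) → size (suc n) ≡ size n + suc (size n)
size-suc n = length-++ (zimin n)

zimin-letters : (n : ℕ) → All (_< n) (zimin n)
zimin-letters zero = []
zimin-letters (suc n) = All.++⁺ smaller (n<1+n n ∷ smaller)
  where
    smaller = All.map m<n⇒m<1+n (zimin-letters n)

zimin-prefix : {e n : ℕ} → e ≤′ n → ∃ λ r → zimin n ≡ zimin e ++ r
zimin-prefix {e} ≤′-refl = [] , sym (++-identityʳ (zimin e))
zimin-prefix {e} (≤′-step {n} e≤n) with zimin-prefix e≤n
... | r , Zₙ≡Zₑr = r ++ n ∷ zimin n , (begin
  zimin n ++ n ∷ zimin n         ≡⟨ cong (_++ n ∷ zimin n) Zₙ≡Zₑr ⟩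
  (zimin e ++ r) ++ n ∷ zimin n  ≡⟨ ++-assoc (zimin e) r (n ∷ zimin n) ⟩
  zimin e ++ r ++ n ∷ zimin n    ∎)
  where open ≡-Reasoning

size-mono : {e n : ℕ} → e ≤ n → size e ≤ size n
size-mono {e} {n} e≤n with zimin-prefix (≤⇒≤′ e≤n)
... | r , Zₙ≡Zₑr = begin
  size e                   ≤⟨ m≤m+n (size e) (length r) ⟩
  size e + length r        ≡⟨ length-++ (zimin e) ⟨
  length (zimin e ++ r)    ≡⟨ cong length Zₙ≡Zₑr ⟨
  size n                   ∎
  where open ≤-Reasoning

size-strict : {e n : ℕ} → e < n → size e < size n
size-strict {e} e<n = <-≤-trans (subst (size e <_) (sym (size-suc e)) (m<m+n (size e) (s≤s z≤n))) (size-mono e<n)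

size-injective : {e n : ℕ} → size e ≡ size n → e ≡ n
size-injective {e} {n} same with <-cmp e n
... | tri< e<n _ _ = ⊥-elim (<⇒≢ (size-strict e<n) same)
... | tri≈ _ e≡n _ = e≡n
... | tri> _ _ n<e = ⊥-elim (<⇒≢ (size-strict n<e) (sym same))

zimin-left : (n : ℕ) {p : ℕ} → p < size n → zimin (suc n) ‼ p ≡ zimin n ‼ p
zimin-left n = ‼-++ˡ (zimin n) (n ∷ zimin n)

zimin-right : (n q : ℕ) → zimin (suc n) ‼ (size n + suc q) ≡ zimin n ‼ q
zimin-right n q = ‼-++ʳ (zimin n) (n ∷ zimin n) (suc q)

zimin-centre : (n : ℕ) → zimin (suc n) ‼ size n ≡ just n
zimin-centre n = trans (cong (zimin (suc n) ‼_) (sym (+-identityʳ (size n))))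
                       (‼-++ʳ (zimin n) (n ∷ zimin n) 0)

zimin-centre-unique : (n p : ℕ) → zimin (suc n) ‼ p ≡ just n → p ≡ size n
zimin-centre-unique n p at-p with <-cmp p (size n)
... | tri< p<c _ _ = ⊥-elim (n≮n n (‼-All p (zimin-letters n) (trans (sym (zimin-left n p<c)) at-p)))
... | tri≈ _ p≡c _ = p≡c
... | tri> _ _ c<p = ⊥-elim (n≮n n (‼-All q (zimin-letters n) (trans (sym (zimin-right n q)) at-c+1+q)))
  where
    q = p ∸ suc (size n)
    at-c+1+q : zimin (suc n) ‼ (size n + suc q) ≡ just n
    at-c+1+q = subst (λ r → zimin (suc n) ‼ r ≡ just n)
                 (trans (sym (m+[n∸m]≡n c<p)) (sym (+-suc (size n) q))) at-p

block-halves : {j m c : ℕ} → j ≤ c → c < j + (m + m) →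
               ∃ λ t → t < m × (j + t ≡ c ⊎ j + m + t ≡ c)
block-halves {j} {m} {c} j≤c c<end with c <? j + m
... | yes c<j+m = c ∸ j , +-cancelˡ-< j (c ∸ j) m (subst (_< j + m) (sym (m+[n∸m]≡n j≤c)) c<j+m) ,
                  inj₁ (m+[n∸m]≡n j≤c)
... | no c≮j+m = c ∸ (j + m) ,
                 +-cancelˡ-< (j + m) (c ∸ (j + m)) m
                   (subst₂ _<_ (sym (m+[n∸m]≡n (≮⇒≥ c≮j+m))) (sym (+-assoc j m m)) c<end) ,
                 inj₂ (m+[n∸m]≡n (≮⇒≥ c≮j+m))

-- Zimin words are square-free: a repetition either lies in one copy of Zₙ
-- inside Zₙ₊₁ = Zₙ n Zₙ, or meets the centre, whose letter n occurs once.
zimin-square-free : (n j m : ℕ) → 1 ≤ m → j + (m + m) ≤ size n → ¬ Repetition (zimin n) j m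
zimin-square-free zero j (suc m) _ fits _ with ≤-trans (m≤n+m (suc m + suc m) j) fits
... | ()
zimin-square-free (suc n) j m 1≤m fits rep with j + (m + m) ≤? size n | size n <? j
... | yes left | _ = zimin-square-free n j m 1≤m left (repetition-++ˡ (zimin n) (n ∷ zimin n) left rep)
... | no _ | yes c<j = zimin-square-free n j' m 1≤m right
                         (repetition-++ʳ (zimin n) (n ∷ zimin n) (subst (λ i → Repetition (zimin (suc n)) i m) j≡ rep))
  where
    j' = j ∸ suc (size n)
    j≡ : j ≡ size n + suc j'
    j≡ = trans (sym (m+[n∸m]≡n c<j)) (sym (+-suc (size n) j'))
    right : j' + (m + m) ≤ size n
    right = s≤s⁻¹ (+-cancelˡ-≤ (size n) _ _ (begin
      size n + suc (j' + (m + m))  ≡⟨ +-assoc (size n) (suc j') (m + m) ⟨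
      size n + suc j' + (m + m)    ≡⟨ cong (_+ (m + m)) j≡ ⟨
      j + (m + m)                  ≤⟨ fits ⟩
      size (suc n)                 ≡⟨ size-suc n ⟩
      size n + suc (size n)        ∎))
      where open ≤-Reasoning
... | no crosses | no c≮j with block-halves (≮⇒≥ c≮j) (≰⇒> crosses)
...   | t , t<m , hit = 1+n≰n (≤-trans 1≤m (≤-reflexive (+-cancelˡ-≡ (j + t) m 0 shifted)))
  where
    same : zimin (suc n) ‼ (j + t) ≡ zimin (suc n) ‼ (j + m + t)
    same = rep t t<m
    at-centre : {p : ℕ} → p ≡ size n → zimin (suc n) ‼ p ≡ just n
    at-centre p≡c = trans (cong (zimin (suc n) ‼_) p≡c) (zimin-centre n)
    -- one end of the matched pair is the centre, so the other one is too
    meets-centre : j + t ≡ size n ⊎ j + m + t ≡ size n → j + t ≡ j + m + t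
    meets-centre (inj₁ first≡c) = trans first≡c (sym (zimin-centre-unique n _ (trans (sym same) (at-centre first≡c))))
    meets-centre (inj₂ second≡c) = trans (zimin-centre-unique n _ (trans same (at-centre second≡c))) (sym second≡c)
    ends : j + t ≡ j + m + t
    ends = meets-centre hit
    shifted : j + t + m ≡ j + t + 0
    shifted = trans (trans (+-assoc j t m) (trans (cong (j +_) (+-comm t m)) (sym (+-assoc j m t))))
                    (trans (sym ends) (sym (+-identityʳ (j + t))))

-- The prefixes u a u (∣u∣ = m - 1) of Zₙ are exactly the words Zₑ e Zₑ, e < n:
-- a shorter one lies in the left copy of Zₙ₋₁, and a longer one would
-- repeat the centre letter n - 1 before the centre.
zimin-periodic-prefix : (n m : ℕ) → 1 ≤ m → m + m ≤ suc (size n) → PeriodicPrefix (zimin n) m →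
                        ∃ λ e → e < n × m ≡ suc (size e)
zimin-periodic-prefix zero (suc m) _ (s≤s fits) _ with ≤-trans (m≤n+m (suc m) m) fits
... | ()
zimin-periodic-prefix (suc n) m 1≤m fits per with m + m ≤? suc (size n) | m ≟ suc (size n)
... | yes left | _ with zimin-periodic-prefix n m 1≤m left (periodicPrefix-++ˡ (zimin n) (n ∷ zimin n) left per)
...   | e , e<n , m≡ = e , m<n⇒m<1+n e<n , m≡
zimin-periodic-prefix (suc n) m 1≤m fits per | no _ | yes m≡ = n , n<1+n n , m≡
zimin-periodic-prefix (suc n) m 1≤m fits per | no long | no m≢ =
  ⊥-elim (1+n≰n (≤-trans 1≤m (≤-reflexive (+-cancelʳ-≡ s m 0 (trans m+s≡c (sym s≡c))))))
  where
    c = size n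
    m≤c : m ≤ c
    m≤c = s≤s⁻¹ (≤∧≢⇒< (≮⇒≥ too-long) m≢)
      where
        too-long : suc c < m → ⊥
        too-long c+1<m = <⇒≱ (+-mono-< c+1<m c+1<m) (subst (λ x → m + m ≤ suc x) (size-suc n) fits)
    s = c ∸ m
    m+s≡c : m + s ≡ c
    m+s≡c = m+[n∸m]≡n m≤c
    s+1<m : suc s < m
    s+1<m = +-cancelˡ-< m (suc s) m (subst (_< m + m) (trans (cong suc (sym m+s≡c)) (sym (+-suc m s))) (≰⇒> long))
    s≡c : s ≡ c
    s≡c = zimin-centre-unique n s (trans (per s s+1<m) (trans (cong (zimin (suc n) ‼_) m+s≡c) (zimin-centre n)))

-- The witness for the second half of the theorem: ◇ Zₖ over an alphabet of
-- size k ≥ 1, the letters of Zₖ (all below k) coded injectively mod k.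
module ZiminWord (k : ℕ) .{{_ : NonZero k}} where

  code : ℕ → Fin k
  code a = a mod k

  code-injective : {a b : ℕ} → a < k → b < k → code a ≡ code b → a ≡ b
  code-injective {a} {b} a<k b<k same = begin
    a             ≡⟨ m<n⇒m%n≡m a<k ⟨
    a % k         ≡⟨ Fin.toℕ-fromℕ< _ ⟨
    toℕ (code a)  ≡⟨ cong toℕ same ⟩
    toℕ (code b)  ≡⟨ Fin.toℕ-fromℕ< _ ⟩
    b % k         ≡⟨ m<n⇒m%n≡m b<k ⟩
    b             ∎
    where open ≡-Reasoning

  Z : List ℕ
  Z = zimin k

  body : PWord k
  body = full (map code Z)

  word : PWord k
  word = nothing ∷ body

  ∣body∣ : length body ≡ size k
  ∣body∣ = trans (length-map just (map code Z)) (length-map code Z)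

  body-! : (p : ℕ) → body ! p ≡ Maybe.map code (Z ‼ p)
  body-! p = trans (full-! (map code Z) p) (‼-map code Z p)

  decode : {p q : ℕ} → p < size k → q < size k → body ! p ↑ body ! q → Z ‼ p ≡ Z ‼ q
  decode {p} {q} p<∣Z∣ q<∣Z∣ compatible with ‼-inRange Z p<∣Z∣ | ‼-inRange Z q<∣Z∣
  ... | a , Z[p]≡a | b , Z[q]≡b =
    trans Z[p]≡a (trans (cong just (code-injective a<k b<k codes)) (sym Z[q]≡b))
    where
      a<k = ‼-All p (zimin-letters k) Z[p]≡a
      b<k = ‼-All q (zimin-letters k) Z[q]≡b
      codes : code a ≡ code b
      codes = subst₂ _↑_ (trans (body-! p) (cong (Maybe.map code) Z[p]≡a))
                         (trans (body-! q) (cong (Maybe.map code) Z[q]≡b)) compatible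

  encode : {p q : ℕ} → Z ‼ p ≡ Z ‼ q → body ! p ↑ body ! q
  encode {p} {q} same = subst (body ! p ↑_) (trans (body-! p) (trans (cong (Maybe.map code) same) (sym (body-! q))))
                              (↑-refl (body ! p))

  prefix-square : {e : ℕ} → e < k → Square word 0 (suc (size e))
  prefix-square {e} e<k = record { nonempty = s≤s z≤n ; fits = s≤s fits ; matches = matches }
    where
      fits : size e + suc (size e) ≤ length body
      fits = begin
        size e + suc (size e)  ≡⟨ size-suc e ⟨
        size (suc e)           ≤⟨ size-mono e<k ⟩
        size k                 ≡⟨ ∣body∣ ⟨
        length body            ∎
        where open ≤-Reasoning
      in-prefix : {p : ℕ} → p < size (suc e) → Z ‼ p ≡ zimin (suc e) ‼ p
      in-prefix {p} p<∣Zₑ₊₁∣ with zimin-prefix (≤⇒≤′ e<k)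
      ... | r , Z≡Zₑ₊₁r = trans (cong (_‼ p) Z≡Zₑ₊₁r) (‼-++ˡ (zimin (suc e)) r p<∣Zₑ₊₁∣)
      matches : (t : ℕ) → t < suc (size e) → word ! t ↑ word ! (suc (size e) + t)
      matches zero _ = tt
      matches (suc s) (s≤s s<∣Zₑ∣) = encode (begin
        Z ‼ s                           ≡⟨ in-prefix (<-≤-trans s<∣Zₑ∣ (size-mono (n≤1+n e))) ⟩
        zimin (suc e) ‼ s               ≡⟨ zimin-left e s<∣Zₑ∣ ⟩
        zimin e ‼ s                     ≡⟨ zimin-right e s ⟨
        zimin (suc e) ‼ (size e + suc s) ≡⟨ in-prefix second ⟨
        Z ‼ (size e + suc s)            ∎)
        where
          open ≡-Reasoning
          second : size e + suc s < size (suc e)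
          second = subst (size e + suc s <_) (sym (size-suc e)) (+-monoʳ-< (size e) (s≤s s<∣Zₑ∣))

  squares-of-word : {j l : ℕ} → SquareAt word (j , l) →
                    j ≡ 0 × ∃ λ e → e < k × l ≡ suc (size e) + suc (size e)
  squares-of-word {suc j} {l} sq with square-half body j l (square-suffix⁺ word 1 j l sq)
  ... | m , _ , in-body = ⊥-elim (zimin-square-free k j m nonempty fits-Z repetition)
    where
      open Square in-body
      fits-Z : j + (m + m) ≤ size k
      fits-Z = subst (j + (m + m) ≤_) ∣body∣ fits
      repetition : Repetition Z j m
      repetition t t<m = decode (≤-<-trans (+-monoʳ-≤ j (m≤n+m t m)) second) (subst (_< size k) (sym (+-assoc j m t)) second) (matches t t<m)
        where
          second : j + (m + t) < size k
          second = <-≤-trans (+-monoʳ-< j (+-monoʳ-< m t<m)) fits-Z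
  squares-of-word {zero} {l} sq with square-half word 0 l sq
  ... | m , l≡m+m , at-start with zimin-periodic-prefix k m nonempty fits-Z periodic
    where
      open Square at-start
      fits-Z : m + m ≤ suc (size k)
      fits-Z = subst (λ n → m + m ≤ suc n) ∣body∣ fits
      periodic : PeriodicPrefix Z m
      periodic s s+1<m = decode (≤-<-trans (m≤n+m s m) second) second
                           (subst (λ n → word ! suc s ↑ word ! n) (+-suc m s) (matches (suc s) s+1<m))
        where
          second : m + s < size k
          second = s≤s⁻¹ (≤-trans (subst (_≤ m + m) (trans (+-suc m (suc s)) (cong suc (+-suc m s))) (+-monoʳ-≤ m s+1<m)) fits-Z)
  ...   | e , e<k , m≡ = refl , e , e<k , trans l≡m+m (cong (λ n → n + n) m≡)

exactly-k-squares : (k : ℕ) → k ≥ 1 →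
  Σ (PWord k) λ w → ExactlyOneSquareStart w ×
    Σ (List (ℕ × ℕ)) λ occs →
      Unique occs × All (SquareAt w) occs × (∀ o → SquareAt w o → o ∈ occs) × length occs ≡ k
exactly-k-squares k@(suc _) _ =
  word , (0 , (2 , square (s≤s z≤n)) , λ j (_ , sq) → proj₁ (squares-of-word sq)) ,
  occs , Unique.map⁺ occurrence-injective (Unique.upTo⁺ k) ,
  All.map⁺ (All.tabulate (square ∘ ∈-upTo⁻)) , complete ,
  trans (length-map occurrence (upTo k)) (length-upTo k)
  where
    open ZiminWord k

    occurrence : ℕ → ℕ × ℕ
    occurrence e = (0 , suc (size e) + suc (size e))

    occs : List (ℕ × ℕ)
    occs = map occurrence (upTo k)

    square : {e : ℕ} → e < k → SquareAt word (occurrence e)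
    square e<k = square-intro (code 0) word 0 _ (prefix-square e<k)

    occurrence-injective : {a b : ℕ} → occurrence a ≡ occurrence b → a ≡ b
    occurrence-injective same =
      size-injective (suc-injective (trans (n≡⌊n+n/2⌋ _) (trans (cong half same) (sym (n≡⌊n+n/2⌋ _)))))

    complete : ∀ o → SquareAt word o → o ∈ occs
    complete (j , l) sq with squares-of-word {j} {l} sq
    ... | refl , e , e<k , refl = ∈-map⁺ occurrence (∈-upTo⁺ e<k)

theorem6 :
    (∀ (k : ℕ) (w : PWord k) → ExactlyOneSquareStart w →
       ∀ (occs : List (ℕ × ℕ)) → Unique occs → All (SquareAt w) occs →
       length occs ≤ k)
    × (∀ (k : ℕ) → k ≥ 1 →
       Σ (PWord k) λ w → ExactlyOneSquareStart w ×
         Σ (List (ℕ × ℕ)) λ occs →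
           Unique occs × All (SquareAt w) occs
           × (∀ o → SquareAt w o → o ∈ occs)
           × length occs ≡ k)
theorem6 = (λ k → at-most-k-squares) , exactly-k-squares
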